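{- Let $X\subseteq\{\mathbf{D},\mathbf{T},\mathbf{4}\}$, $\mathbf{L}=\mathbf{LIK}X$, and let $\mathcal{M}_{\mathbf{L}}=(W_{\mathbf{L}},\leq_{\mathbf{L}},R_{\mathbf{L}},V_{\mathbf{L}})$ be its canonical model. For every formula $A$ and every $\Gamma\in W_{\mathbf{L}}$: $A\in\Gamma$ if and only if $\mathcal{M}_{\mathbf{L}},\Gamma\Vdash A$.
   Context: Formulas: $A::=p\mid A\supset A\mid \top\mid\bot\mid A\vee A\mid A\wedge A\mid \square A\mid \lozenge A$; $\neg A:=A\supset\bot$. $\mathbf{LIK}X$ is the set of formulas derivable from: axioms of intuitionistic propositional logic, $\square(p\supset q)\supset(\square p\supset\square q)$, $\square(p\supset q)\supset(\lozenge p\supset\lozenge q)$, $\lozenge(p\vee q)\supset\lozenge p\vee\lozenge q$, $\square(p\vee q)\supset\lozenge p\vee\square q$, $\neg\lozenge\bot$, plus $\lozenge\top$ if $\mathbf{D}\in X$, $(\square p\supset p)\wedge(p\supset\lozenge p)$ if $\mathbf{T}\in X$, $(\square p\supset\square\square p)\wedge(\lozenge\lozenge p\supset\lozenge p)$ if $\mathbf{4}\in X$ (with substitution instances), under modus ponens and necessitation. A theory contains $\mathbf{L}$ and is closed under modus ponens; proper if $\bot\notin\Gamma$; prime if proper and $A\vee B\in\Gamma$ implies $A\in\Gamma$ or $B\in\Gamma$. Canonical model: $W_{\mathbf{L}}$ = prime theories; $\Gamma\leq_{\mathbf{L}}\Delta$ iff $\Gamma\subseteq\Delta$; $R_{\mathbf{L}}\Gamma\Delta$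 iff $\{A:\square A\in\Gamma\}\subseteq\Delta$ and $\{\lozenge A:A\in\Delta\}\subseteq\Gamma$; $V_{\mathbf{L}}(p)=\{\Gamma:p\in\Gamma\}$. Forcing: $x\Vdash p$ iff $x\in V(p)$; $\top,\bot,\wedge,\vee$ pointwise; $x\Vdash A\supset B$ iff for all $x'\geq x$, $x'\Vdash A$ implies $x'\Vdash B$; $x\Vdash\square A$ iff $y\Vdash A$ for all $y$ with $Rxy$; $x\Vdash\lozenge A$ iff $y\Vdash A$ for some $y$ with $Rxy$. -}

module Defs where

open import Level using (Level; Lift; lift) renaming (suc to lsuc; zero to lzero)
open import Data.Nat using (ℕ)
open import Data.Bool using (Bool; true; false)
open import Data.Empty using (⊥)
open import Data.Unit using (⊤)
open import Data.Product using (Σ; ∃; _×_; _,_; proj₁)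
open import Data.Sum using (_⊎_)
open import Relation.Nullary using (¬_)
open import Relation.Binary.PropositionalEquality using (_≡_)

infixr 5 _⊃_
infixr 6 _∨_
infixr 7 _∧_

data Fm : Set where
  var  : ℕ → Fm
  _⊃_  : Fm → Fm → Fm
  ⊤'   : Fm
  ⊥'   : Fm
  _∨_  : Fm → Fm → Fm
  _∧_  : Fm → Fm → Fm
  □    : Fm → Fm
  ◇    : Fm → Fm

¬' : Fm → Fm
¬' A = A ⊃ ⊥'

record Ext : Set where
  field
    hasD : Bool
    hasT : Bool
    has4 : Bool
open Ext public

data Axiom (X : Ext) : Fm → Set where
  ax-K     : ∀ A B → Axiom X (A ⊃ B ⊃ A)
  ax-S     : ∀ A B C → Axiom X ((A ⊃ B ⊃ C) ⊃ (A ⊃ B) ⊃ A ⊃ C)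
  ax-∧E₁   : ∀ A B → Axiom X (A ∧ B ⊃ A)
  ax-∧E₂   : ∀ A B → Axiom X (A ∧ B ⊃ B)
  ax-∧I    : ∀ A B → Axiom X (A ⊃ B ⊃ A ∧ B)
  ax-∨I₁   : ∀ A B → Axiom X (A ⊃ A ∨ B)
  ax-∨I₂   : ∀ A B → Axiom X (B ⊃ A ∨ B)
  ax-∨E    : ∀ A B C → Axiom X ((A ⊃ C) ⊃ (B ⊃ C) ⊃ (A ∨ B ⊃ C))
  ax-⊥E    : ∀ A → Axiom X (⊥' ⊃ A)
  ax-⊤     : Axiom X ⊤'
  ax-K□    : ∀ A B → Axiom X (□ (A ⊃ B) ⊃ □ A ⊃ □ B)
  ax-K◇    : ∀ A B → Axiom X (□ (A ⊃ B) ⊃ ◇ A ⊃ ◇ B)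
  ax-◇∨    : ∀ A B → Axiom X (◇ (A ∨ B) ⊃ ◇ A ∨ ◇ B)
  ax-□∨    : ∀ A B → Axiom X (□ (A ∨ B) ⊃ ◇ A ∨ □ B)
  ax-N     : Axiom X (¬' (◇ ⊥'))
  ax-D     : hasD X ≡ true → Axiom X (◇ ⊤')
  ax-T     : hasT X ≡ true → ∀ A → Axiom X ((□ A ⊃ A) ∧ (A ⊃ ◇ A))
  ax-4     : has4 X ≡ true → ∀ A → Axiom X ((□ A ⊃ □ (□ A)) ∧ (◇ (◇ A) ⊃ ◇ A))

data LIK (X : Ext) : Fm → Set where
  axm : ∀ {A} → Axiom X A → LIK X A
  mp  : ∀ {A B} → LIK X (A ⊃ B) → LIK X A → LIK X B
  nec : ∀ {A} → LIK X A → LIK X (□ A)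

FmSet : Set₁
FmSet = Fm → Set

record IsTheory (X : Ext) (Γ : FmSet) : Set where
  field
    containsL : ∀ {A} → LIK X A → Γ A
    closedMP  : ∀ {A B} → Γ (A ⊃ B) → Γ A → Γ B

record IsPrimeTheory (X : Ext) (Γ : FmSet) : Set where
  field
    theory : IsTheory X Γ
    proper : ¬ Γ ⊥'
    prime  : ∀ {A B} → Γ (A ∨ B) → Γ A ⊎ Γ B

record Model (ℓ : Level) : Set (lsuc ℓ) where
  field
    W   : Set ℓ
    _≤_ : W → W → Set ℓ
    R   : W → W → Set ℓ
    V   : ℕ → W → Set ℓ

module _ {ℓ : Level} (M : Model ℓ) where
  open Model M
  infix 4 _⊩_
  _⊩_ : W → Fm → Set ℓ
  x ⊩ var p  = V p x
  x ⊩ (A ⊃ B) = ∀ x' → x ≤ x' → x' ⊩ A → x' ⊩ B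
  x ⊩ ⊤'     = Lift ℓ ⊤
  x ⊩ ⊥'     = Lift ℓ ⊥
  x ⊩ (A ∨ B) = x ⊩ A ⊎ x ⊩ B
  x ⊩ (A ∧ B) = x ⊩ A × x ⊩ B
  x ⊩ □ A    = ∀ y → R x y → y ⊩ A
  x ⊩ ◇ A    = Σ W λ y → R x y × y ⊩ A

WL : Ext → Set₁
WL X = Σ FmSet (IsPrimeTheory X)

CanonicalModel : Ext → Model (lsuc lzero)
CanonicalModel X = record
  { W   = WL X
  ; _≤_ = λ Γ Δ → Lift (lsuc lzero) (∀ A → proj₁ Γ A → proj₁ Δ A)
  ; R   = λ Γ Δ → Lift (lsuc lzero) ((∀ A → proj₁ Γ (□ A) → proj₁ Δ A)
                                   × (∀ A → proj₁ Δ A → proj₁ Γ (◇ A)))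
  ; V   = λ p Γ → Lift (lsuc lzero) (proj₁ Γ (var p))
  }

-- The paper's metatheory is classical (Lindenbaum-style prime extension).
-- Excluded middle, as an explicit meta-level assumption.
ExcludedMiddle : Set₂
ExcludedMiddle = (P : Set₁) → P ⊎ ¬ P

module Submission where

-- The only non-trivial cases of the truth
-- lemma are refuting A ⊃ B and □A and witnessing ◇A at a prime theory Γ, and each
-- is a prime extension avoiding a set Ψ that is closed under ∨ and contains ⊥:
-- Ψ = {C : ⊢ C ⊃ B} for A ⊃ B, Ψ = {C : ⊢ C ⊃ D ∨ A for some ◇D ∉ Γ} for □A
-- (this is where □(p ∨ q) ⊃ ◇p ∨ □q enters), and Ψ = {C : ◇C ∉ Γ} for ◇A.
-- Such extensions come from a Lindenbaum construction along an enumeration of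
-- formulas. Excluded middle enters in primeness, in the ◇-half of R and in the
-- converse direction of the truth lemma for ⊃ and □.

open import Defs
open import Level using (Lift; lift; lower)
open import Data.Nat using (ℕ; zero; suc; _+_; _⊔_; _≤′_; ≤′-refl; ≤′-step)
open import Data.Nat.Properties using (+-suc; +-identityʳ; m≤m⊔n; m≤n⊔m; ≤⇒≤′)
open import Data.Empty using (⊥-elim)
open import Data.Unit using (tt)
open import Data.Product using (Σ; ∃; _×_; _,_; proj₁; proj₂; uncurry)
open import Data.Sum using (_⊎_; inj₁; inj₂; [_,_])
import Data.Sum as Sum
open import Function using (id; _∘_)
open import Relation.Nullary using (¬_)
open import Relation.Nullary.Decidable using (Dec; yes; no; ¬¬-excluded-middle; decidable-stable)
open import Relation.Unary using (_⊆_; ∅; ｛_｝; _∪_)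
open import Relation.Binary.PropositionalEquality
  using (_≡_; refl; sym; trans; cong; subst)

Hits : {S : Set} → (ℕ → S) → S → Set
Hits f s = ∃ λ n → f n ≡ s

Hits-map : {S T : Set} {f : ℕ → S} {s : S} (g : S → T) → Hits f s → Hits (g ∘ f) (g s)
Hits-map g (n , fn≡s) = n , cong g fn≡s

next : ℕ × ℕ → ℕ × ℕ
next (zero  , b) = suc b , zero
next (suc a , b) = a , suc b

-- Cantor's zig-zag (0,0), (1,0), (0,1), (2,0), (1,1), (0,2), …
unpair : ℕ → ℕ × ℕ
unpair zero    = zero , zero
unpair (suc n) = next (unpair n)

unpair-hits-next : ∀ {p} → Hits unpair p → Hits unpair (next p)
unpair-hits-next (n , n↦p) = suc n , cong next n↦p

unpair-hits-antidiagonal : ∀ b a → Hits unpair (b + a , 0) → Hits unpair (a , b)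
unpair-hits-antidiagonal zero    a h = h
unpair-hits-antidiagonal (suc b) a h =
  unpair-hits-next (unpair-hits-antidiagonal b (suc a)
    (subst (λ d → Hits unpair (d , 0)) (sym (+-suc b a)) h))

unpair-hits-axis : ∀ d → Hits unpair (d , 0)
unpair-hits-axis zero    = 0 , refl
unpair-hits-axis (suc d) =
  unpair-hits-next (unpair-hits-antidiagonal d 0
    (subst (λ d′ → Hits unpair (d′ , 0)) (sym (+-identityʳ d)) (unpair-hits-axis d)))

unpair-surjective : ∀ p → Hits unpair p
unpair-surjective (a , b) = unpair-hits-antidiagonal b a (unpair-hits-axis (b + a))

combine : (Fm → Fm → Fm) → (ℕ → Fm) → ℕ → Fm
combine op f = uncurry (λ i j → op (f i) (f j)) ∘ unpair

combine-hits : ∀ {op f A B} → Hits f A → Hits f B → Hits (combine op f) (op A B)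
combine-hits {op} {f} (i , refl) (j , refl) =
  Hits-map (uncurry (λ i j → op (f i) (f j))) (unpair-surjective (i , j))

-- The tag 0, like every unused tag, repeats f, so that the levels are cumulative.
oneLayer : (ℕ → Fm) → ℕ × ℕ → Fm
oneLayer f (1 , _) = ⊤'
oneLayer f (2 , _) = ⊥'
oneLayer f (3 , m) = combine _⊃_ f m
oneLayer f (4 , m) = combine _∨_ f m
oneLayer f (5 , m) = combine _∧_ f m
oneLayer f (6 , m) = □ (f m)
oneLayer f (7 , m) = ◇ (f m)
oneLayer f (_ , m) = f m

level : ℕ → ℕ → Fm
level zero    = var
level (suc k) = oneLayer (level k) ∘ unpair

level-hits-tag : ∀ k t {A} → Hits (λ m → oneLayer (level k) (t , m)) A → Hits (level (suc k)) A
level-hits-tag k t (m , m↦A) with unpair-surjective (t , m)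
... | n , n↦tm = n , trans (cong (oneLayer (level k)) n↦tm) m↦A

level-hits-mono : ∀ {k k′ A} → k ≤′ k′ → Hits (level k) A → Hits (level k′) A
level-hits-mono ≤′-refl          h = h
level-hits-mono (≤′-step {n} k≤′k′) h = level-hits-tag n 0 (level-hits-mono k≤′k′ h)

level-hits-common : ∀ {A B} → ∃ (λ k → Hits (level k) A) → ∃ (λ k → Hits (level k) B) →
                    ∃ λ k → Hits (level k) A × Hits (level k) B
level-hits-common (k , hA) (k′ , hB) =
  k ⊔ k′ , level-hits-mono (≤⇒≤′ (m≤m⊔n k k′)) hA , level-hits-mono (≤⇒≤′ (m≤n⊔m k k′)) hB

level-surjective : ∀ A → ∃ λ k → Hits (level k) A
level-surjective (var p) = 0 , p , refl
level-surjective ⊤'      = 1 , level-hits-tag 0 1 (0 , refl)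
level-surjective ⊥'      = 1 , level-hits-tag 0 2 (0 , refl)
level-surjective (A ⊃ B) with level-hits-common (level-surjective A) (level-surjective B)
... | k , hA , hB = suc k , level-hits-tag k 3 (combine-hits hA hB)
level-surjective (A ∨ B) with level-hits-common (level-surjective A) (level-surjective B)
... | k , hA , hB = suc k , level-hits-tag k 4 (combine-hits hA hB)
level-surjective (A ∧ B) with level-hits-common (level-surjective A) (level-surjective B)
... | k , hA , hB = suc k , level-hits-tag k 5 (combine-hits hA hB)
level-surjective (□ A) with level-surjective A
... | k , hA = suc k , level-hits-tag k 6 (Hits-map □ hA)
level-surjective (◇ A) with level-surjective A
... | k , hA = suc k , level-hits-tag k 7 (Hits-map ◇ hA)

enumerate : ℕ → Fm
enumerate = uncurry level ∘ unpair

enumerate-surjective : ∀ A → Hits enumerate A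
enumerate-surjective A with level-surjective A
... | k , i , i↦A with unpair-surjective (k , i)
... | n , n↦ki = n , trans (cong (uncurry level) n↦ki) i↦A

decide : ExcludedMiddle → (P : Set) → Dec P
decide em P with em (Lift _ P)
... | inj₁ (lift p) = yes p
... | inj₂ ¬p       = no (¬p ∘ lift)

¬¬-elim : ExcludedMiddle → {P : Set} → ¬ ¬ P → P
¬¬-elim em {P} = decidable-stable (decide em P)

module _ (X : Ext) where

  variable
    A B C D : Fm
    Θ Θ′ : FmSet

  infix 3 _⊢_
  data _⊢_ (Θ : FmSet) : Fm → Set where
    hyp : Θ A → Θ ⊢ A
    thm : LIK X A → Θ ⊢ A
    app : Θ ⊢ A ⊃ B → Θ ⊢ A → Θ ⊢ B

  ⊢-mono : Θ ⊆ Θ′ → Θ ⊢ A → Θ′ ⊢ A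
  ⊢-mono Θ⊆Θ′ (hyp h)   = hyp (Θ⊆Θ′ h)
  ⊢-mono Θ⊆Θ′ (thm t)   = thm t
  ⊢-mono Θ⊆Θ′ (app d e) = app (⊢-mono Θ⊆Θ′ d) (⊢-mono Θ⊆Θ′ e)

  axiom : Axiom X A → Θ ⊢ A
  axiom = thm ∘ axm

  ⊢-id : Θ ⊢ A ⊃ A
  ⊢-id {A = A} = app (app (axiom (ax-S A (A ⊃ A) A)) (axiom (ax-K A (A ⊃ A)))) (axiom (ax-K A A))

  deduction : Θ ∪ ｛ A ｝ ⊢ B → Θ ⊢ A ⊃ B
  deduction (hyp (inj₁ h))    = app (axiom (ax-K _ _)) (hyp h)
  deduction (hyp (inj₂ refl)) = ⊢-id
  deduction (thm t)           = app (axiom (ax-K _ _)) (thm t)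
  deduction (app d e)         = app (app (axiom (ax-S _ _ _)) (deduction d)) (deduction e)

  ⊢-trans : Θ ⊢ A ⊃ B → Θ ⊢ B ⊃ C → Θ ⊢ A ⊃ C
  ⊢-trans f g = deduction (app (⊢-mono inj₁ g) (app (⊢-mono inj₁ f) (hyp (inj₂ refl))))

  ⊢-∨-elim : Θ ⊢ A ⊃ C → Θ ⊢ B ⊃ C → Θ ⊢ A ∨ B ⊃ C
  ⊢-∨-elim f g = app (app (axiom (ax-∨E _ _ _)) f) g

  ⊢-∨-map : Θ ⊢ A ⊃ C → Θ ⊢ B ⊃ D → Θ ⊢ A ∨ B ⊃ C ∨ D
  ⊢-∨-map f g = ⊢-∨-elim (⊢-trans f (axiom (ax-∨I₁ _ _))) (⊢-trans g (axiom (ax-∨I₂ _ _)))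

  ∅⊢⇒LIK : ∅ ⊢ A → LIK X A
  ∅⊢⇒LIK (thm t)   = t
  ∅⊢⇒LIK (app d e) = mp (∅⊢⇒LIK d) (∅⊢⇒LIK e)

  Avoids : FmSet → FmSet → Set
  Avoids Ψ Θ = ∀ {C} → Θ ⊢ C → ¬ Ψ C

  infix 4 _∋_
  _∋_ : WL X → Fm → Set
  Γ ∋ A = proj₁ Γ A

  unbox : WL X → FmSet
  unbox Γ A = Γ ∋ □ A

  module PrimeTheory (Γ : WL X) where
    open IsPrimeTheory (proj₂ Γ) public using (proper; prime)

    ⊢-closed : proj₁ Γ ⊢ A → Γ ∋ A
    ⊢-closed (hyp h)   = h
    ⊢-closed (thm t)   = IsTheory.containsL (IsPrimeTheory.theory (proj₂ Γ)) t
    ⊢-closed (app d e) = IsTheory.closedMP (IsPrimeTheory.theory (proj₂ Γ)) (⊢-closed d) (⊢-closed e)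

    axiom∈ : Axiom X A → Γ ∋ A
    axiom∈ = ⊢-closed ∘ axiom

    mp∈ : Γ ∋ A ⊃ B → Γ ∋ A → Γ ∋ B
    mp∈ h k = ⊢-closed (app (hyp h) (hyp k))

    □-closed : unbox Γ ⊢ A → Γ ∋ □ A
    □-closed (hyp h)   = h
    □-closed (thm t)   = ⊢-closed (thm (nec t))
    □-closed (app d e) = mp∈ (mp∈ (axiom∈ (ax-K□ _ _)) (□-closed d)) (□-closed e)

    ◇⊥∉ : ¬ Γ ∋ ◇ ⊥'
    ◇⊥∉ h = proper (mp∈ (axiom∈ ax-N) h)

    ◇∨∉ : ¬ Γ ∋ ◇ A → ¬ Γ ∋ ◇ B → ¬ Γ ∋ ◇ (A ∨ B)
    ◇∨∉ ◇A∉ ◇B∉ h = [ ◇A∉ , ◇B∉ ] (prime (mp∈ (axiom∈ (ax-◇∨ _ _)) h))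

  open Model (CanonicalModel X) using (_≤_; R)

  infix 4 _⊩ᶜ_
  _⊩ᶜ_ : WL X → Fm → Set₁
  _⊩ᶜ_ = _⊩_ (CanonicalModel X)

  module _ (em : ExcludedMiddle) where

    module Lindenbaum (Ψ : FmSet) (Ψ-∨ : ∀ {B C} → Ψ B → Ψ C → Ψ (B ∨ C)) (Ψ-⊥ : Ψ ⊥')
                      (Θ : FmSet) (Θ-avoids : Avoids Ψ Θ) where

      stage : ℕ → FmSet
      stage zero      = Θ
      stage (suc n) D = stage n D ⊎ (enumerate n ≡ D × Avoids Ψ (stage n ∪ ｛ enumerate n ｝))

      limit : FmSet
      limit D = ∃ λ n → stage n D

      stage-mono : ∀ {m n} → m ≤′ n → stage m ⊆ stage n
      stage-mono ≤′-refl          h = h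
      stage-mono (≤′-step m≤′n) h = inj₁ (stage-mono m≤′n h)

      limit-compact : limit ⊢ A → ∃ λ n → stage n ⊢ A
      limit-compact (hyp (n , h)) = n , hyp h
      limit-compact (thm t)       = 0 , thm t
      limit-compact (app d e) with limit-compact d | limit-compact e
      ... | m , d′ | n , e′ = m ⊔ n , app (⊢-mono (stage-mono (≤⇒≤′ (m≤m⊔n m n))) d′)
                                          (⊢-mono (stage-mono (≤⇒≤′ (m≤n⊔m m n))) e′)

      -- The goal is ⊥, so we may case on whether the n-th formula was admitted.
      stage-avoids : ∀ n → Avoids Ψ (stage n)
      stage-avoids zero    = Θ-avoids
      stage-avoids (suc n) d σ = ¬¬-excluded-middle λ where
          (yes admitted) → admitted (⊢-mono (Sum.map₂ proj₁) d) σ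
          (no rejected)  → stage-avoids n (⊢-mono [ id , ⊥-elim ∘ rejected ∘ proj₂ ] d) σ

      limit-avoids : Avoids Ψ limit
      limit-avoids d σ with limit-compact d
      ... | n , d′ = stage-avoids n d′ σ

      admit : Avoids Ψ (limit ∪ ｛ A ｝) → limit A
      admit {A} avoids with enumerate-surjective A
      ... | n , refl = suc n , inj₂ (refl , avoids ∘ ⊢-mono (Sum.map₁ (n ,_)))

      limit-⊢-closed : limit ⊢ A → limit A
      limit-⊢-closed d = admit λ d′ → limit-avoids (app (deduction d′) d)

      limit-prime : limit (A ∨ B) → limit A ⊎ limit B
      limit-prime {A} {B} A∨B with decide em (Avoids Ψ (limit ∪ ｛ A ｝))
      ... | yes avoidsA = inj₁ (admit avoidsA)
      ... | no ¬avoidsA = inj₂ (admit λ dB σB → ¬avoidsA λ dA σA →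
              limit-avoids (app (⊢-∨-map (deduction dA) (deduction dB)) (hyp A∨B)) (Ψ-∨ σA σB))

      limit-isPrimeTheory : IsPrimeTheory X limit
      limit-isPrimeTheory = record
        { theory = record { containsL = limit-⊢-closed ∘ thm
                          ; closedMP  = λ h k → limit-⊢-closed (app (hyp h) (hyp k)) }
        ; proper = λ h → limit-avoids (hyp h) Ψ-⊥
        ; prime  = limit-prime
        }

    prime-extension : (Ψ : FmSet) → (∀ {B C} → Ψ B → Ψ C → Ψ (B ∨ C)) → Ψ ⊥' →
                      (Θ : FmSet) → Avoids Ψ Θ →
                      Σ (WL X) λ Δ → Θ ⊆ proj₁ Δ × Avoids Ψ (proj₁ Δ)
    prime-extension Ψ Ψ-∨ Ψ-⊥ Θ Θ-avoids = (limit , limit-isPrimeTheory) , (0 ,_) , limit-avoids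
      where open Lindenbaum Ψ Ψ-∨ Ψ-⊥ Θ Θ-avoids

    ⊃-counterworld : (Γ : WL X) → ¬ Γ ∋ A ⊃ B → Σ (WL X) λ Δ → Γ ≤ Δ × Δ ∋ A × ¬ Δ ∋ B
    ⊃-counterworld {A} {B} Γ A⊃B∉Γ
      with prime-extension (λ C → LIK X (C ⊃ B)) ⊢-∨ (axm (ax-⊥E B)) (proj₁ Γ ∪ ｛ A ｝) Γ,A-avoids
      where
        ⊢-∨ : LIK X (C ⊃ B) → LIK X (D ⊃ B) → LIK X (C ∨ D ⊃ B)
        ⊢-∨ f g = ∅⊢⇒LIK (⊢-∨-elim (thm f) (thm g))
        Γ,A-avoids : Avoids (λ C → LIK X (C ⊃ B)) (proj₁ Γ ∪ ｛ A ｝)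
        Γ,A-avoids d C⊃B = A⊃B∉Γ (PrimeTheory.⊢-closed Γ (deduction (app (thm C⊃B) d)))
    ... | Δ , Γ,A⊆Δ , avoids =
      Δ , lift (λ _ → Γ,A⊆Δ ∘ inj₁) , Γ,A⊆Δ (inj₂ refl) , λ B∈Δ → avoids (hyp B∈Δ) (∅⊢⇒LIK ⊢-id)

    □-counterworld : (Γ : WL X) → ¬ Γ ∋ □ A → Σ (WL X) λ Δ → R Γ Δ × ¬ Δ ∋ A
    □-counterworld {A} Γ □A∉Γ
      with prime-extension Ψ Ψ-∨ (⊥' , ◇⊥∉ , axm (ax-⊥E _)) (unbox Γ) unbox-avoids
      where
        open PrimeTheory Γ
        Ψ : FmSet
        Ψ C = ∃ λ D → ¬ Γ ∋ ◇ D × LIK X (C ⊃ D ∨ A)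
        Ψ-∨ : Ψ B → Ψ C → Ψ (B ∨ C)
        Ψ-∨ (D₁ , ◇D₁∉ , f) (D₂ , ◇D₂∉ , g) = D₁ ∨ D₂ , ◇∨∉ ◇D₁∉ ◇D₂∉ , ∅⊢⇒LIK
          (⊢-∨-elim (⊢-trans (thm f) (⊢-∨-map (axiom (ax-∨I₁ _ _)) ⊢-id))
                    (⊢-trans (thm g) (⊢-∨-map (axiom (ax-∨I₂ _ _)) ⊢-id)))
        unbox-avoids : Avoids Ψ (unbox Γ)
        unbox-avoids d (D , ◇D∉ , f) =
          [ ◇D∉ , □A∉Γ ] (prime (mp∈ (axiom∈ (ax-□∨ D A)) (□-closed (app (thm f) d))))
    ... | Δ , unbox⊆Δ , avoids =
      Δ , lift ((λ _ → unbox⊆Δ) , ◇-back) ,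
      λ A∈Δ → avoids (hyp A∈Δ) (⊥' , PrimeTheory.◇⊥∉ Γ , axm (ax-∨I₂ ⊥' A))
      where
        ◇-back : ∀ C → Δ ∋ C → Γ ∋ ◇ C
        ◇-back C C∈Δ = ¬¬-elim em λ ◇C∉Γ → avoids (hyp C∈Δ) (C , ◇C∉Γ , axm (ax-∨I₁ C A))

    ◇-witness : (Γ : WL X) → Γ ∋ ◇ A → Σ (WL X) λ Δ → R Γ Δ × Δ ∋ A
    ◇-witness {A} Γ ◇A∈Γ
      with prime-extension (λ C → ¬ Γ ∋ ◇ C) ◇∨∉ ◇⊥∉ (unbox Γ ∪ ｛ A ｝) unbox,A-avoids
      where
        open PrimeTheory Γ
        unbox,A-avoids : Avoids (λ C → ¬ Γ ∋ ◇ C) (unbox Γ ∪ ｛ A ｝)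
        unbox,A-avoids d ◇C∉Γ = ◇C∉Γ (mp∈ (mp∈ (axiom∈ (ax-K◇ _ _)) (□-closed (deduction d))) ◇A∈Γ)
    ... | Δ , unbox,A⊆Δ , avoids =
      Δ , lift ((λ _ → unbox,A⊆Δ ∘ inj₁) , λ _ C∈Δ → ¬¬-elim em (avoids (hyp C∈Δ))) ,
      unbox,A⊆Δ (inj₂ refl)

    truth⇒ : ∀ A (Γ : WL X) → Γ ∋ A → Γ ⊩ᶜ A
    truth⇐ : ∀ A (Γ : WL X) → Γ ⊩ᶜ A → Γ ∋ A

    truth⇒ (var p) Γ h = lift h
    truth⇒ ⊤'      Γ _ = lift tt
    truth⇒ ⊥'      Γ h = ⊥-elim (PrimeTheory.proper Γ h)
    truth⇒ (A ∧ B) Γ h =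
      truth⇒ A Γ (mp∈ (axiom∈ (ax-∧E₁ _ _)) h) , truth⇒ B Γ (mp∈ (axiom∈ (ax-∧E₂ _ _)) h)
      where open PrimeTheory Γ
    truth⇒ (A ∨ B) Γ h = Sum.map (truth⇒ A Γ) (truth⇒ B Γ) (PrimeTheory.prime Γ h)
    truth⇒ (A ⊃ B) Γ h Δ Γ≤Δ ⊩A = truth⇒ B Δ (PrimeTheory.mp∈ Δ (lower Γ≤Δ _ h) (truth⇐ A Δ ⊩A))
    truth⇒ (□ A)   Γ h Δ RΓΔ = truth⇒ A Δ (proj₁ (lower RΓΔ) _ h)
    truth⇒ (◇ A)   Γ h with ◇-witness Γ h
    ... | Δ , RΓΔ , A∈Δ = Δ , RΓΔ , truth⇒ A Δ A∈Δ

    truth⇐ (var p) Γ = lower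
    truth⇐ ⊤'      Γ _ = PrimeTheory.axiom∈ Γ ax-⊤
    truth⇐ ⊥'      Γ (lift ())
    truth⇐ (A ∧ B) Γ (⊩A , ⊩B) = mp∈ (mp∈ (axiom∈ (ax-∧I _ _)) (truth⇐ A Γ ⊩A)) (truth⇐ B Γ ⊩B)
      where open PrimeTheory Γ
    truth⇐ (A ∨ B) Γ =
      [ mp∈ (axiom∈ (ax-∨I₁ _ _)) ∘ truth⇐ A Γ , mp∈ (axiom∈ (ax-∨I₂ _ _)) ∘ truth⇐ B Γ ]
      where open PrimeTheory Γ
    truth⇐ (A ⊃ B) Γ ⊩A⊃B = ¬¬-elim em λ A⊃B∉Γ →
      let Δ , Γ≤Δ , A∈Δ , B∉Δ = ⊃-counterworld Γ A⊃B∉Γ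
      in B∉Δ (truth⇐ B Δ (⊩A⊃B Δ Γ≤Δ (truth⇒ A Δ A∈Δ)))
    truth⇐ (□ A)   Γ ⊩□A = ¬¬-elim em λ □A∉Γ →
      let Δ , RΓΔ , A∉Δ = □-counterworld Γ □A∉Γ
      in A∉Δ (truth⇐ A Δ (⊩□A Δ RΓΔ))
    truth⇐ (◇ A)   Γ (Δ , RΓΔ , ⊩A) = proj₂ (lower RΓΔ) _ (truth⇐ A Δ ⊩A)

lemma6 : ExcludedMiddle → (X : Ext) (A : Fm) (Γ : WL X) →
    (proj₁ Γ A → _⊩_ (CanonicalModel X) Γ A) × (_⊩_ (CanonicalModel X) Γ A → proj₁ Γ A)
lemma6 em X A Γ = truth⇒ X em A Γ , truth⇐ X em A Γ
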